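{- For $n\ge 1$ let $s_n=(n,n-1,\dots,2,1)$. Then $\mathrm{SG}(s_n)=1$ if $n$ is odd and $\mathrm{SG}(s_n)=0$ if $n$ is even.
   Context: LCTR: positions are partitions; from nonempty $\lambda=(\lambda_1,\dots,\lambda_k)$ one may move to $T(\lambda)=(\lambda_2,\dots,\lambda_k)$ or $L(\lambda)=(\lambda_1-1,\dots,\lambda_k-1)$ (nonpositive entries omitted); $()$ has no moves. $\mathrm{SG}(())=0$, $\mathrm{SG}(\lambda)=\mathrm{mex}\{\mathrm{SG}(L(\lambda)),\mathrm{SG}(T(\lambda))\}$ otherwise, with $\mathrm{mex}(B)$ the least nonnegative integer not in $B$. -}

module Defs where

open import Data.Nat using (ℕ; zero; suc; _∸_; _≡ᵇ_; _+_)
open import Data.Bool using (if_then_else_)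
open import Data.List using (List; []; _∷_; map; length)
open import Data.Nat.ListAction using (sum)
open import Data.Bool using (Bool; true; false; _∨_)

-- A partition is represented as a list of positive naturals in
-- nonincreasing order, λ = (λ₁, …, λ_k).
Partition : Set
Partition = List ℕ

T : Partition → Partition
T []       = []
T (_ ∷ xs) = xs

dropZeros : List ℕ → List ℕ
dropZeros []          = []
dropZeros (zero ∷ xs) = dropZeros xs
dropZeros (suc x ∷ xs) = suc x ∷ dropZeros xs

L : Partition → Partition
L xs = dropZeros (map (λ x → x ∸ 1) xs)

elem : ℕ → List ℕ → Bool
elem n []       = false
elem n (x ∷ xs) = (n ≡ᵇ x) ∨ elem n xs

mexFrom : ℕ → ℕ → List ℕ → ℕ
mexFrom zero     start B = start
mexFrom (suc f)  start B = if elem start B then mexFrom f (suc start) B else start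

-- mex(B): the least nonnegative integer not in B (a search of
-- length B + 1 candidates always suffices, by pigeonhole)
mex : List ℕ → ℕ
mex B = mexFrom (suc (length B)) 0 B

-- Sprague–Grundy value with explicit fuel.  Both moves strictly decrease
-- the sum of the entries of a nonempty partition, so fuel ≥ sum λ + 1
-- suffices to compute the true value.
SGf : ℕ → Partition → ℕ
SGf _         []        = 0
SGf zero      (_ ∷ _)   = 0
SGf (suc f)   (x ∷ xs)  = mex (SGf f (L (x ∷ xs)) ∷ SGf f (T (x ∷ xs)) ∷ [])

SG : Partition → ℕ
SG xs = SGf (suc (sum xs)) xs

staircase : ℕ → Partition
staircase zero    = []
staircase (suc n) = suc n ∷ staircase n

-- From s_{n+1} both moves lead to s_n: dropping the first part gives
-- (n, …, 1), and lowering every part drops the trailing 1 to give the same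
-- partition.  So SG(s_{n+1}) = mex {SG(s_n)}, and SG alternates 0, 1, 0, 1, …
module Submission where

open import Defs
open import Data.Nat using (ℕ; _≤_; _%_; zero; suc; z≤n; s≤s)
open import Data.Nat.Properties using (m≤m+n)
open import Data.Nat.ListAction using (sum)
open import Data.Product using (_×_; _,_)
open import Data.List using ([]; _∷_)
open import Relation.Binary.PropositionalEquality using (_≡_; refl; trans; cong)

L-staircase : ∀ n → L (staircase (suc n)) ≡ staircase n
L-staircase zero    = refl
L-staircase (suc n) = cong (suc n ∷_) (L-staircase n)

mex-duplicate-parity : ∀ n → mex (n % 2 ∷ n % 2 ∷ []) ≡ suc n % 2
mex-duplicate-parity zero          = refl
mex-duplicate-parity (suc zero)    = refl
mex-duplicate-parity (suc (suc n)) = mex-duplicate-parity n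

SGf-staircase : ∀ {f} n → n ≤ f → SGf (suc f) (staircase n) ≡ n % 2
SGf-staircase zero    _         = refl
SGf-staircase (suc n) (s≤s n≤f)
  rewrite L-staircase n | SGf-staircase n n≤f = mex-duplicate-parity n

staircase-length≤sum : ∀ n → n ≤ sum (staircase n)
staircase-length≤sum zero    = z≤n
staircase-length≤sum (suc n) = m≤m+n (suc n) (sum (staircase n))

SG-staircase : ∀ n → SG (staircase n) ≡ n % 2
SG-staircase n = SGf-staircase n (staircase-length≤sum n)

lemma3p10 : (n : ℕ) → 1 ≤ n →
    ((n % 2 ≡ 1 → SG (staircase n) ≡ 1) × (n % 2 ≡ 0 → SG (staircase n) ≡ 0))
lemma3p10 n _ = trans (SG-staircase n) , trans (SG-staircase n)
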